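{- Let $0\le i<j<x\le n$ with $pen_{\alpha h}(i,x)>0$ and $pen_{\alpha h}(j,x)>0$. If $highest(i,x)=highest(j,x)$, then there is a constant $L_{\alpha,i,j}$, not depending on $y$, such that $pen_{\alpha h}(i,y)-pen_{\alpha h}(j,y)=L_{\alpha,i,j}$ for all $y\in\{x,\dots,n\}$.
   Context: Customers $1,\dots,n$ in tour order with deliveries $d_z\ge 0$, pickups $p_z\ge0$; capacity $Q\ge 0$; penalty factor $\alpha\ge 0$. Let $P[k]=\sum_{z=1}^{k}p_z$, $D[k]=\sum_{z=1}^{k}d_z$. For $0\le i\le m\le k\le n$, $load(i,m,k)=P[m]-P[i]+D[k]-D[m]$. For $0\le i<k\le n$, $highest(i,k)$ is the largest index $m\in\{i,\dots,k\}$ maximizing $load(i,m,k)$ (ties broken toward the largest index), and $pen_{\alpha h}(i,k)=\alpha\max\big(load(i,highest(i,k),k)-Q,\,0\big)$ is the capacity penalty of the route serving customers $i+1,\dots,k$.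
   Formalization: The deliveries $d_z$, pickups $p_z$, capacity $Q$ and penalty factor $\alpha$ take values in the rationals. -}

module Defs where

open import Data.Nat using (ℕ; zero; suc) renaming (_+_ to _+ℕ_; _∸_ to _∸ℕ_)
open import Data.Bool using (if_then_else_)
open import Data.Rational using (ℚ; 0ℚ; _+_; _-_; _*_; _⊔_; _≤ᵇ_)

-- Prefix sums: S f k = f 1 + ... + f k  (customers are indexed 1..n)
S : (ℕ → ℚ) → ℕ → ℚ
S f zero = 0ℚ
S f (suc k) = S f k + f (suc k)

load : (d p : ℕ → ℚ) → ℕ → ℕ → ℕ → ℚ
load d p i m k = S p m - S p i + S d k - S d m

-- argmax of m ↦ load(i,m,k) over m ∈ {i, ..., i+c}, ties broken toward the largest index
highestAux : (d p : ℕ → ℚ) → ℕ → ℕ → ℕ → ℕ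
highestAux d p i k zero = i
highestAux d p i k (suc c) =
  let m  = highestAux d p i k c
      m′ = i +ℕ suc c
  in if load d p i m k ≤ᵇ load d p i m′ k then m′ else m

highest : (d p : ℕ → ℚ) → ℕ → ℕ → ℕ
highest d p i k = highestAux d p i k (k ∸ℕ i)

pen : (d p : ℕ → ℚ) (Q α : ℚ) → ℕ → ℕ → ℚ
pen d p Q α i k = α * ((load d p i (highest d p i k) k - Q) ⊔ 0ℚ)

-- Write h = highest(i,x) and c = P[j] - P[i] ≥ 0. Moving the start of a route from i to j
-- lowers every load(·,m,·) with m ≥ j by exactly c, and moving its end from x to y raises
-- every load by D[y] - D[x]. The loads with m < j therefore stay below load(i,h,·), and
-- since j ≤ h the maximal load from i is the maximal load from j plus c for every y ≥ x.
-- Both maxima stay above Q, so the difference of penalties is the constant α·c.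
module Submission where

open import Defs
open import Data.Nat using (ℕ; zero; suc; _<_; _≤_; _∸_; z≤n; s≤s) renaming (_+_ to _+ℕ_)
import Data.Nat.Properties as ℕP
open import Data.Rational using (ℚ; 0ℚ; _+_; _-_; _*_; -_; _⊔_; _≤ᵇ_)
  renaming (_≤_ to _≤ℚ_; _<_ to _<ℚ_)
import Data.Rational.Properties as ℚP
open import Data.Bool using (T; true; false)
open import Data.Product using (Σ; _,_)
open import Function using (_$_)
open import Data.Sum using (inj₁; inj₂)
open import Relation.Nullary using (yes; no)
open import Relation.Nullary.Decidable.Core using (dec⇒maybe)
open import Relation.Binary.PropositionalEquality
  using (_≡_; refl; sym; cong; subst; module ≡-Reasoning)
open import Level using (0ℓ)
import Tactic.RingSolver as RingSolver
open import Tactic.RingSolver.Core.AlmostCommutativeRing using (AlmostCommutativeRing; fromCommutativeRing)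

ℚ-ring : AlmostCommutativeRing 0ℓ 0ℓ
ℚ-ring = fromCommutativeRing ℚP.+-*-commutativeRing (λ x → dec⇒maybe (0ℚ ℚP.≟ x))

p≤q⇒0≤q-p : ∀ {p q} → p ≤ℚ q → 0ℚ ≤ℚ q - p
p≤q⇒0≤q-p {p} {q} p≤q = subst (_≤ℚ q - p) (ℚP.+-inverseʳ p) (ℚP.+-monoˡ-≤ (- p) p≤q)

p≤p+q : ∀ p {q} → 0ℚ ≤ℚ q → p ≤ℚ p + q
p≤p+q p {q} 0≤q = subst (_≤ℚ p + q) (ℚP.+-identityʳ p) (ℚP.+-monoʳ-≤ p 0≤q)

0<r*[p⊔0]⇒0<p : ∀ r p → 0ℚ <ℚ r * (p ⊔ 0ℚ) → 0ℚ <ℚ p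
0<r*[p⊔0]⇒0<p r p 0<r*[p⊔0] with p ℚP.≤? 0ℚ
... | no p≰0 = ℚP.≰⇒> p≰0
... | yes p≤0 with () ← ℚP.<-irrefl (sym (ℚP.*-zeroʳ r))
                        (subst (λ t → 0ℚ <ℚ r * t) (ℚP.p≤q⇒p⊔q≡q p≤0) 0<r*[p⊔0])

*-⊔0-shift : ∀ α v c Q → 0ℚ ≤ℚ v - Q → 0ℚ ≤ℚ c
           → α * ((v + c - Q) ⊔ 0ℚ) - α * ((v - Q) ⊔ 0ℚ) ≡ α * c
*-⊔0-shift α v c Q 0≤v-Q 0≤c = begin
  α * ((v + c - Q) ⊔ 0ℚ) - α * ((v - Q) ⊔ 0ℚ)
    ≡⟨ cong (λ t → α * t - α * ((v - Q) ⊔ 0ℚ)) (ℚP.p≥q⇒p⊔q≡p 0≤v+c-Q) ⟩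
  α * (v + c - Q) - α * ((v - Q) ⊔ 0ℚ)
    ≡⟨ cong (λ t → α * (v + c - Q) - α * t) (ℚP.p≥q⇒p⊔q≡p 0≤v-Q) ⟩
  α * (v + c - Q) - α * (v - Q)
    ≡⟨ *-distribˡ-cancel α v c Q ⟩
  α * c ∎
  where
  open ≡-Reasoning
  reassoc : ∀ v c Q → v - Q + c ≡ v + c - Q
  reassoc = RingSolver.solve-∀ ℚ-ring
  0≤v+c-Q : 0ℚ ≤ℚ v + c - Q
  0≤v+c-Q = subst (0ℚ ≤ℚ_) (reassoc v c Q) (ℚP.+-mono-≤ 0≤v-Q 0≤c)
  *-distribˡ-cancel : ∀ α v c Q → α * (v + c - Q) - α * (v - Q) ≡ α * c
  *-distribˡ-cancel = RingSolver.solve-∀ ℚ-ring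

S-mono : ∀ f n → (∀ z → 1 ≤ z → z ≤ n → 0ℚ ≤ℚ f z)
       → ∀ {a b} → a ≤ b → b ≤ n → S f a ≤ℚ S f b
S-mono f n f≥0 {a} {zero} z≤n _ = ℚP.≤-refl
S-mono f n f≥0 {a} {suc b} a≤1+b 1+b≤n with ℕP.m≤n⇒m<n∨m≡n a≤1+b
... | inj₂ refl = ℚP.≤-refl
... | inj₁ (s≤s a≤b) = ℚP.≤-trans (S-mono f n f≥0 a≤b (ℕP.≤-trans (ℕP.n≤1+n b) 1+b≤n))
                                   (p≤p+q (S f b) (f≥0 (suc b) (s≤s z≤n) 1+b≤n))

module _ (d p : ℕ → ℚ) where

  load-shiftˡ : ∀ i j m k → load d p i m k ≡ load d p j m k + (S p j - S p i)
  load-shiftˡ i j m k = identity (S p m) (S p i) (S d k) (S d m) (S p j)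
    where
    identity : ∀ pm pi dk dm pj → pm - pi + dk - dm ≡ (pm - pj + dk - dm) + (pj - pi)
    identity = RingSolver.solve-∀ ℚ-ring

  load-shiftʳ : ∀ i m x y → load d p i m y ≡ load d p i m x + (S d y - S d x)
  load-shiftʳ i m x y = identity (S p m) (S p i) (S d y) (S d m) (S d x)
    where
    identity : ∀ pm pi dy dm dx → pm - pi + dy - dm ≡ (pm - pi + dx - dm) + (dy - dx)
    identity = RingSolver.solve-∀ ℚ-ring

  LoadsBelow : ℕ → ℕ → ℕ → ℚ → Set
  LoadsBelow i k u v = ∀ m → i ≤ m → m ≤ u → load d p i m k ≤ℚ v

  record IsMaxLoad (i k u h : ℕ) : Set where
    constructor isMaxLoad
    field
      start≤ : i ≤ h
      ≤bound : h ≤ u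
      maximal : LoadsBelow i k u (load d p i h k)

  loadsBelow-suc : ∀ {i k c v} → LoadsBelow i k (i +ℕ c) v → load d p i (i +ℕ suc c) k ≤ℚ v
                 → LoadsBelow i k (i +ℕ suc c) v
  loadsBelow-suc {i} {k} {c} below new≤v m i≤m m≤i+1+c with ℕP.m≤n⇒m<n∨m≡n m≤i+1+c
  ... | inj₂ refl = new≤v
  ... | inj₁ m<i+1+c = below m i≤m (ℕP.≤-pred (subst (suc m ≤_) (ℕP.+-suc i c) m<i+1+c))

  highestAux-isMaxLoad : ∀ i k c → IsMaxLoad i k (i +ℕ c) (highestAux d p i k c)
  highestAux-isMaxLoad i k zero = isMaxLoad ℕP.≤-refl (ℕP.≤-reflexive (sym (ℕP.+-identityʳ i))) only-i
    where
    only-i : LoadsBelow i k (i +ℕ 0) (load d p i i k)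
    only-i m i≤m m≤i+0 rewrite ℕP.+-identityʳ i | ℕP.≤-antisym m≤i+0 i≤m = ℚP.≤-refl
  highestAux-isMaxLoad i k (suc c)
    with highestAux-isMaxLoad i k c
       | load d p i (highestAux d p i k c) k ≤ᵇ load d p i (i +ℕ suc c) k in test
  ... | isMaxLoad _ _ below | true =
    isMaxLoad (ℕP.m≤m+n i (suc c)) ℕP.≤-refl $
    loadsBelow-suc {k = k} (λ m i≤m m≤i+c → ℚP.≤-trans (below m i≤m m≤i+c) h≤new) ℚP.≤-refl
    where
    h≤new : load d p i (highestAux d p i k c) k ≤ℚ load d p i (i +ℕ suc c) k
    h≤new = ℚP.≤ᵇ⇒≤ (subst T (sym test) _)
  ... | isMaxLoad i≤h h≤i+c below | false =
    isMaxLoad i≤h (ℕP.≤-trans h≤i+c (ℕP.+-monoʳ-≤ i (ℕP.n≤1+n c)))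
              (loadsBelow-suc {k = k} below (ℚP.<⇒≤ new<h))
    where
    new<h : load d p i (i +ℕ suc c) k <ℚ load d p i (highestAux d p i k c) k
    new<h = ℚP.≰⇒> (λ new≤h → subst T test (ℚP.≤⇒≤ᵇ new≤h))

  highest-isMaxLoad : ∀ {i k} → i ≤ k → IsMaxLoad i k k (highest d p i k)
  highest-isMaxLoad {i} {k} i≤k = subst (λ u → IsMaxLoad i k u (highest d p i k))
    (ℕP.m+[n∸m]≡n i≤k) (highestAux-isMaxLoad i k (k ∸ i))

  peakLoad : ℕ → ℕ → ℚ
  peakLoad i k = load d p i (highest d p i k) k

  load≤peakLoad : ∀ {i m k} → i ≤ m → m ≤ k → load d p i m k ≤ℚ peakLoad i k
  load≤peakLoad {i} {m} {k} i≤m m≤k with highest-isMaxLoad (ℕP.≤-trans i≤m m≤k)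
  ... | isMaxLoad _ _ below = below m i≤m m≤k

  peakLoad≤ : ∀ {i k v} → i ≤ k → LoadsBelow i k k v → peakLoad i k ≤ℚ v
  peakLoad≤ i≤k below with highest-isMaxLoad i≤k
  ... | isMaxLoad i≤h h≤k _ = below _ i≤h h≤k

  peakLoad-monoʳ : ∀ {i x y} → i ≤ x → x ≤ y → S d x ≤ℚ S d y → peakLoad i x ≤ℚ peakLoad i y
  peakLoad-monoʳ {i} {x} {y} i≤x x≤y Sx≤Sy with highest-isMaxLoad i≤x
  ... | isMaxLoad i≤h h≤x _ = begin
    peakLoad i x                                  ≤⟨ p≤p+q (peakLoad i x) (p≤q⇒0≤q-p Sx≤Sy) ⟩
    peakLoad i x + (S d y - S d x)                ≡⟨ load-shiftʳ i (highest d p i x) x y ⟨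
    load d p i (highest d p i x) y                ≤⟨ load≤peakLoad i≤h (ℕP.≤-trans h≤x x≤y) ⟩
    peakLoad i y                                  ∎
    where open ℚP.≤-Reasoning

  peakLoad-shiftˡ : ∀ {i j x y} → i ≤ j → j ≤ x → x ≤ y → j ≤ highest d p i x
                  → peakLoad i y ≡ peakLoad j y + (S p j - S p i)
  peakLoad-shiftˡ {i} {j} {x} {y} i≤j j≤x x≤y j≤h =
    ℚP.≤-antisym (peakLoad≤ (ℕP.≤-trans i≤x x≤y) loads-below) peak-j+c≤peak-i
    where
    open ℚP.≤-Reasoning
    c = S p j - S p i
    h = highest d p i x
    i≤x = ℕP.≤-trans i≤j j≤x
    j≤y = ℕP.≤-trans j≤x x≤y

    through-j : ∀ {m} → j ≤ m → m ≤ y → load d p i m y ≤ℚ peakLoad j y + c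
    through-j {m} j≤m m≤y = begin
      load d p i m y      ≡⟨ load-shiftˡ i j m y ⟩
      load d p j m y + c  ≤⟨ ℚP.+-monoˡ-≤ c (load≤peakLoad j≤m m≤y) ⟩
      peakLoad j y + c    ∎

    loads-below : LoadsBelow i y y (peakLoad j y + c)
    loads-below m i≤m m≤y with j ℕP.≤? m
    ... | yes j≤m = through-j j≤m m≤y
    ... | no m≱j = begin
      load d p i m y                      ≡⟨ load-shiftʳ i m x y ⟩
      load d p i m x + (S d y - S d x)    ≤⟨ ℚP.+-monoˡ-≤ _ (load≤peakLoad i≤m m≤x) ⟩
      load d p i h x + (S d y - S d x)    ≡⟨ load-shiftʳ i h x y ⟨
      load d p i h y                      ≤⟨ through-j j≤h h≤y ⟩
      peakLoad j y + c                    ∎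
      where
      m≤x = ℕP.≤-trans (ℕP.<⇒≤ (ℕP.≰⇒> m≱j)) j≤x
      h≤y = ℕP.≤-trans (IsMaxLoad.≤bound (highest-isMaxLoad i≤x)) x≤y

    peak-j+c≤peak-i : peakLoad j y + c ≤ℚ peakLoad i y
    peak-j+c≤peak-i with highest-isMaxLoad j≤y
    ... | isMaxLoad j≤hⱼ hⱼ≤y _ = begin
      peakLoad j y + c                ≡⟨ load-shiftˡ i j (highest d p j y) y ⟨
      load d p i (highest d p j y) y  ≤⟨ load≤peakLoad (ℕP.≤-trans i≤j j≤hⱼ) hⱼ≤y ⟩
      peakLoad i y                    ∎

lemma2 : (n : ℕ) (d p : ℕ → ℚ) (Q α : ℚ)
         → (∀ z → 1 ≤ z → z ≤ n → 0ℚ ≤ℚ d z)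
         → (∀ z → 1 ≤ z → z ≤ n → 0ℚ ≤ℚ p z)
         → 0ℚ ≤ℚ Q → 0ℚ ≤ℚ α
         → (i j x : ℕ) → i < j → j < x → x ≤ n
         → 0ℚ <ℚ pen d p Q α i x → 0ℚ <ℚ pen d p Q α j x
         → highest d p i x ≡ highest d p j x
         → Σ ℚ (λ L → ∀ y → x ≤ y → y ≤ n → pen d p Q α i y - pen d p Q α j y ≡ L)
lemma2 n d p Q α d≥0 p≥0 _ _ i j x i<j j<x x≤n _ pen-jx>0 same-highest =
  α * c , difference
  where
  open ℚP.≤-Reasoning
  c = S p j - S p i
  i≤j = ℕP.<⇒≤ i<j
  j≤x = ℕP.<⇒≤ j<x
  c≥0 = p≤q⇒0≤q-p (S-mono p n p≥0 i≤j (ℕP.≤-trans j≤x x≤n))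
  j≤highest-i = subst (j ≤_) (sym same-highest) (IsMaxLoad.start≤ (highest-isMaxLoad d p j≤x))

  difference : ∀ y → x ≤ y → y ≤ n → pen d p Q α i y - pen d p Q α j y ≡ α * c
  difference y x≤y y≤n = begin-equality
    α * ((peakLoad d p i y - Q) ⊔ 0ℚ) - α * ((peakLoad d p j y - Q) ⊔ 0ℚ)
      ≡⟨ cong (λ v → α * ((v - Q) ⊔ 0ℚ) - α * ((peakLoad d p j y - Q) ⊔ 0ℚ))
              (peakLoad-shiftˡ d p i≤j j≤x x≤y j≤highest-i) ⟩
    α * ((peakLoad d p j y + c - Q) ⊔ 0ℚ) - α * ((peakLoad d p j y - Q) ⊔ 0ℚ)
      ≡⟨ *-⊔0-shift α (peakLoad d p j y) c Q excess-j≥0 c≥0 ⟩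
    α * c ∎
    where
    excess-j≥0 : 0ℚ ≤ℚ peakLoad d p j y - Q
    excess-j≥0 = begin
      0ℚ                     <⟨ 0<r*[p⊔0]⇒0<p α _ pen-jx>0 ⟩
      peakLoad d p j x - Q   ≤⟨ ℚP.+-monoˡ-≤ (- Q) (peakLoad-monoʳ d p j≤x x≤y (S-mono d n d≥0 x≤y y≤n)) ⟩
      peakLoad d p j y - Q   ∎
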